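{- Let $n\ge 1$ and $k\ge 1$, and let $\nu\in S_{k-1}$. Then $a_n(\nu;k\to 1)=a_n(c_1(\nu^r);k\to 1)$.
   Context: Standard cycle form of $\sigma\in S_n$: product of disjoint cycles (fixed points included), each cycle starting with its largest element, cycles listed in increasing order of largest elements. The fundamental bijection $\theta:S_n\to S_n$ erases the parentheses of the standard cycle form to give a one-line permutation. For $\pi\in S_n$, $\hat\pi=\theta^{ -1}(\pi)$. An arrow pattern $(\nu;H)$ of size $k$: a string $\nu=a_1\dots a_m$ of positive integers and a set $H$ of arrows $b\to c$, with all integers appearing forming $[k]$. $\pi\in S_n$ contains $(\nu;H)$ if there is $X=\{x_1<\dots<x_k\}\subseteq[n]$ with positions $t_1<\dots<t_m$ such that $\pi_{t_1}\cdots\pi_{t_m}=x_{a_1}\cdots x_{a_m}$ and $\hat\pi(x_b)=x_c$ for every arrow $b\to c\in H$; otherwise it avoids it. $a_n(\nu;H)$ = number of $\pi\in S_n$ avoiding $(\nu;H)$. For $\tau=\tau_1\cdots\tau_m\in S_m$, the reverse is $\tau^r=\tau_m\cdots\tau_1$, and the 1-complement $c_1(\tau)$ is the permutation obtained by keeping the entry $1$ in place and replacing every other entry $\tau_i\neq1$ by $(m+2)-\tau_i$ (i.e. complementing all entries except $1$ among $\{2,\dots,m\}$). For example $c_1(623154)=265134$. -}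

module Defs where

open import Data.Nat using (ℕ; zero; suc; _+_; _∸_; _≤ᵇ_; _≡ᵇ_)
import Data.Nat as ℕ
open import Data.Bool using (Bool; true; false; if_then_else_; _∧_; not)
open import Data.List using (List; []; _∷_; _++_; map; concatMap; length; filterᵇ; upTo; reverse)
open import Data.Bool.ListAction using (any; all)
open import Data.List.Properties using (≡-dec)
open import Data.Product using (_×_; _,_)
open import Relation.Nullary using (does)
import Data.List.Relation.Binary.Sublist.DecPropositional as SubDec
open SubDec ℕ._≟_ using (_⊆?_)

-- Conventions: a permutation of [n] = {1,…,n} is represented in one-line
-- notation as a list of naturals π₁ … πₙ.

range : ℕ → List ℕ
range n = map suc (upTo n)

-- 1-based lookup (x_a for a list X = x₁ … x_k); default 0 out of range.
nth : List ℕ → ℕ → ℕ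
nth []       _             = 0
nth (x ∷ xs) zero          = 0
nth (x ∷ xs) (suc zero)    = x
nth (x ∷ xs) (suc (suc i)) = nth xs (suc i)

app : List ℕ → ℕ → ℕ
app σ x = nth σ x

insertions : ℕ → List ℕ → List (List ℕ)
insertions x []       = (x ∷ []) ∷ []
insertions x (y ∷ ys) = (x ∷ y ∷ ys) ∷ map (y ∷_) (insertions x ys)

S : ℕ → List (List ℕ)
S zero    = [] ∷ []
S (suc n) = concatMap (insertions (suc n)) (S n)

cycleFrom : List ℕ → ℕ → List ℕ
cycleFrom σ m = m ∷ go (length σ) (app σ m)
  where
  go : ℕ → ℕ → List ℕ
  go zero    _ = []
  go (suc f) y = if y ≡ᵇ m then [] else y ∷ go f (app σ y)

isCycleMax : List ℕ → ℕ → Bool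
isCycleMax σ m = all (λ y → y ≤ᵇ m) (cycleFrom σ m)

standardCycleForm : List ℕ → List (List ℕ)
standardCycleForm σ =
  concatMap (λ m → if isCycleMax σ m then cycleFrom σ m ∷ [] else []) (range (length σ))

θ : List ℕ → List ℕ
θ σ = concatMap (λ c → c) (standardCycleForm σ)

-- π̂ = θ⁻¹(π): the (unique) σ ∈ S_n with θ σ = π
hat : List ℕ → List ℕ
hat π with filterᵇ (λ σ → does (≡-dec ℕ._≟_ (θ σ) π)) (S (length π))
... | []    = π
... | σ ∷ _ = σ

record ArrowPattern : Set where
  constructor ⟨_,_,_⟩
  field
    size   : ℕ
    word   : List ℕ
    arrows : List (ℕ × ℕ)     -- (b , c) stands for the arrow b → c

choose : ℕ → List ℕ → List (List ℕ)
choose zero    _        = [] ∷ []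
choose (suc k) []       = []
choose (suc k) (x ∷ xs) = map (x ∷_) (choose k xs) ++ choose (suc k) xs

contains : ArrowPattern → List ℕ → Bool
contains ⟨ k , ν , H ⟩ π =
  any (λ X → does (map (nth X) ν ⊆? π)
             ∧ all (λ { (b , c) → app (hat π) (nth X b) ≡ᵇ nth X c }) H)
      (choose k (range (length π)))

a : ℕ → ArrowPattern → ℕ
a n p = length (filterᵇ (λ π → not (contains p π)) (S n))

c₁ : List ℕ → List ℕ
c₁ τ = map (λ t → if t ≡ᵇ 1 then 1 else (length τ + 2) ∸ t) τ

{-# OPTIONS --safe #-}
-- For π = θ(σ) and a < b, σ(b) = a exactly when b is immediately followed by a in π: a descent
-- inside a cycle is a step of σ, while consecutive cycles meet in an ascent because cycle maxima
-- increase. (To use this for π̂ we show that θ is onto S_n, cutting π into blocks at its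
-- left-to-right maxima.) So π contains (ν; k → 1) iff some points x₁ < ⋯ < x_k carry an occurrence
-- of ν, which does not use x_k, and x_k x₁ is a factor of π. The reverse complement π^rc (reverse,
-- then x ↦ x̄ = n+1−x), an involution of S_n, turns this factor into x̄₁ x̄_k and the occurrence of ν
-- into one of c₁(ν^r) on the points x̄_k < ⋯ < x̄₁, except that the letter 1 sits on x̄₁ instead of
-- on x̄_k. Hence
-- π ↦ π^rc matches the avoiders of the two patterns.

module Submission where

open import Defs
open import Data.Bool using (Bool; true; false; T; not; if_then_else_)
open import Data.Bool.Properties using (T-∧)
open import Data.Empty using (⊥; ⊥-elim)
open import Data.List
  using (List; []; _∷_; _++_; [_]; map; concat; concatMap; length; filter; filterᵇ; upTo; reverse)
open import Data.List.Properties
open import Data.List.Membership.Propositional using (_∈_; _∉_; find; lose)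
open import Data.List.Membership.Propositional.Properties
  using ( ∈-map⁺; ∈-map⁻; ∈-++⁺ˡ; ∈-++⁺ʳ; ∈-++⁻; ∈-∃++; ∈-filter⁺; ∈-filter⁻
        ; ∈-concatMap⁺; ∈-concatMap⁻; ∈-upTo⁺; ∈-upTo⁻)
open import Data.List.Membership.Propositional.Properties.WithK using (unique∧set⇒bag)
open import Data.List.Relation.Binary.BagAndSetEquality using (∼bag⇒↭)
open import Data.List.Relation.Binary.Permutation.Propositional
  using (_↭_; ↭-refl; ↭-prep; ↭-sym; ↭⇒↭ₛ; module PermutationReasoning)
open import Data.List.Relation.Binary.Permutation.Propositional.Properties
  using (↭-length; ∈-resp-↭; All-resp-↭; drop-mid; ↭-empty-inv; ∷↭∷ʳ; shift; filter-↭; ↭-reverse)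
import Data.List.Relation.Binary.Permutation.Propositional.Properties as PermP
import Data.List.Relation.Binary.Permutation.Setoid.Properties as PermSetoid
open import Data.List.Relation.Binary.Sublist.Propositional using (_⊆_; []; _∷_; _∷ʳ_)
import Data.List.Relation.Binary.Sublist.Propositional.Properties as SublistP
open import Data.List.Relation.Unary.All as All using (All; []; _∷_)
import Data.List.Relation.Unary.All.Properties as AllP
open import Data.List.Relation.Unary.AllPairs as AP using (AllPairs; []; _∷_)
import Data.List.Relation.Unary.AllPairs.Properties as APP
open import Data.List.Relation.Unary.Any using (here; there)
import Data.List.Relation.Unary.Any.Properties as AnyP
open import Data.List.Relation.Unary.Unique.Propositional using (Unique)
import Data.List.Relation.Unary.Unique.Propositional.Properties as UniqueP
open import Data.Nat using (ℕ; zero; suc; _+_; _∸_; _≤_; _<_; _≟_; _≡ᵇ_; _≤ᵇ_; z≤n; s≤s)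
open import Data.Nat.Properties
open import Data.List.Relation.Binary.Sublist.DecPropositional _≟_ using (_⊆?_)
open import Data.Product using (Σ; ∃; ∃₂; _×_; _,_; proj₁; proj₂)
open import Data.Sum using (_⊎_; inj₁; inj₂)
open import Function using (_∘_; id)
open import Function.Bundles using (Equivalence; mk⇔)
open import Relation.Binary.Definitions using (tri<; tri≈; tri>)
open import Relation.Binary.PropositionalEquality hiding ([_])
open import Relation.Nullary using (¬_; ¬?; Dec; yes; no; does)
open import Relation.Nullary.Decidable using (T?)

T-does⁺ : ∀ {P : Set} (d : Dec P) → P → T (does d)
T-does⁺ (yes _) _ = _
T-does⁺ (no ¬p) p = ¬p p

T-does⁻ : ∀ {P : Set} (d : Dec P) → T (does d) → P
T-does⁻ (yes p) _ = p

T-ext : ∀ {a b : Bool} → (T a → T b) → (T b → T a) → a ≡ b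
T-ext {false} {false} _ _ = refl
T-ext {false} {true}  _ b→a = ⊥-elim (b→a _)
T-ext {true}  {false} a→b _ = ⊥-elim (a→b _)
T-ext {true}  {true}  _ _ = refl

≡ᵇ-refl : ∀ m → (m ≡ᵇ m) ≡ true
≡ᵇ-refl zero    = refl
≡ᵇ-refl (suc m) = ≡ᵇ-refl m

≢⇒≡ᵇ-false : ∀ {m n} → m ≢ n → (m ≡ᵇ n) ≡ false
≢⇒≡ᵇ-false {m} {n} m≢n with m ≡ᵇ n in eq
... | true  = ⊥-elim (m≢n (≡ᵇ⇒≡ m n (subst T (sym eq) _)))
... | false = refl

Unique-map⁺ : ∀ {A B : Set} (f : A → B) {xs} → Unique xs →
  (∀ {x y} → x ∈ xs → y ∈ xs → f x ≡ f y → x ≡ y) → Unique (map f xs)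
Unique-map⁺ f {[]}     _          _   = []
Unique-map⁺ f {x ∷ xs} (x∉xs ∷ u) inj =
  AllP.map⁺ (All.tabulate (λ y∈xs fx≡fy → All.lookup x∉xs y∈xs (inj (here refl) (there y∈xs) fx≡fy)))
  ∷ Unique-map⁺ f u (λ p q → inj (there p) (there q))

Unique-concatMap⁺ : ∀ {A B : Set} (f : A → List B) (g : B → A) {xs} → Unique xs →
  (∀ {x} → x ∈ xs → Unique (f x)) → (∀ {x y} → x ∈ xs → y ∈ f x → g y ≡ x) →
  Unique (concatMap f xs)
Unique-concatMap⁺ f g {[]}     _           _        _       = []
Unique-concatMap⁺ f g {x ∷ xs} (x∉xs ∷ uxs) uf retract =
  UniqueP.++⁺ (uf (here refl)) (Unique-concatMap⁺ f g uxs (uf ∘ there) (retract ∘ there)) disjoint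
  where
  disjoint : ∀ {y} → ¬ (y ∈ f x × y ∈ concatMap f xs)
  disjoint (y∈fx , y∈rest) with x′ , x′∈xs , y∈fx′ ← find (∈-concatMap⁻ f y∈rest) =
    All.lookup x∉xs x′∈xs (trans (sym (retract (here refl) y∈fx)) (retract (there x′∈xs) y∈fx′))

AllPairs-++⁻ˡ : ∀ {A : Set} {R : A → A → Set} xs {ys} → AllPairs R (xs ++ ys) → AllPairs R xs
AllPairs-++⁻ˡ []       _            = []
AllPairs-++⁻ˡ (x ∷ xs) (x~ ∷ rest) = AllP.++⁻ˡ xs x~ ∷ AllPairs-++⁻ˡ xs rest

AllPairs-++⁻ʳ : ∀ {A : Set} {R : A → A → Set} xs {ys} → AllPairs R (xs ++ ys) → AllPairs R ys
AllPairs-++⁻ʳ []       p          = p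
AllPairs-++⁻ʳ (x ∷ xs) (_ ∷ rest) = AllPairs-++⁻ʳ xs rest

strictlySorted-≡ : ∀ {xs ys} → AllPairs _<_ xs → AllPairs _<_ ys →
  (∀ {z} → z ∈ xs → z ∈ ys) → (∀ {z} → z ∈ ys → z ∈ xs) → xs ≡ ys
strictlySorted-≡ {[]}     {[]}     _ _ _ _ = refl
strictlySorted-≡ {[]}     {y ∷ ys} _ _ _ from with () ← from (here refl)
strictlySorted-≡ {x ∷ xs} {[]}     _ _ to _ with () ← to (here refl)
strictlySorted-≡ {x ∷ xs} {y ∷ ys} (x< ∷ sxs) (y< ∷ sys) to from =
  cong₂ _∷_ x≡y (strictlySorted-≡ sxs sys (λ z∈ → tail x< x≡y z∈ (to (there z∈)))
    (λ z∈ → tail y< (sym x≡y) z∈ (from (there z∈))))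
  where
  x≡y : x ≡ y
  x≡y with to (here refl) | from (here refl)
  ... | here x≡y  | _         = x≡y
  ... | there _   | here y≡x  = sym y≡x
  ... | there y<∈ | there x<∈ = ⊥-elim (<-asym (All.lookup y< y<∈) (All.lookup x< x<∈))
  tail : ∀ {u v us vs z} → All (u <_) us → u ≡ v → z ∈ us → z ∈ v ∷ vs → z ∈ vs
  tail u< refl z∈us (here refl) = ⊥-elim (<-irrefl refl (All.lookup u< z∈us))
  tail u< refl z∈us (there z∈)  = z∈

Unique-concatMap⁻ : ∀ {A B : Set} (f : A → List B) xs {x} → Unique (concatMap f xs) → x ∈ xs → Unique (f x)
Unique-concatMap⁻ f (x ∷ xs) u (here refl) = AllPairs-++⁻ˡ (f x) u
Unique-concatMap⁻ f (y ∷ xs) u (there x∈)  = Unique-concatMap⁻ f xs (AllPairs-++⁻ʳ (f y) u) x∈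

⊆-∷⁻ : ∀ {A : Set} {y : A} {xs ys} → y ∉ xs → xs ⊆ y ∷ ys → xs ⊆ ys
⊆-∷⁻ _   (_ ∷ʳ xs⊆)   = xs⊆
⊆-∷⁻ y∉ (refl ∷ _)   = ⊥-elim (y∉ (here refl))

AllPairs-⊆ : ∀ {A : Set} {R : A → A → Set} {xs ys} → xs ⊆ ys → AllPairs R ys → AllPairs R xs
AllPairs-⊆ []          []           = []
AllPairs-⊆ (y ∷ʳ xs⊆)  (_ ∷ rys)    = AllPairs-⊆ xs⊆ rys
AllPairs-⊆ (refl ∷ xs⊆) (y~ ∷ rys)  = SublistP.All-resp-⊆ xs⊆ y~ ∷ AllPairs-⊆ xs⊆ rys

concatMap-↭ : ∀ {A B : Set} {f g : A → List B} → (∀ x → f x ↭ g x) → ∀ xs → concatMap f xs ↭ concatMap g xs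
concatMap-↭ f↭g []       = ↭-refl
concatMap-↭ f↭g (x ∷ xs) = PermP.++⁺ (f↭g x) (concatMap-↭ f↭g xs)

length-concatMap-≥ : ∀ {A B : Set} (f : A → List B) {x} xs → x ∈ xs → length (f x) ≤ length (concatMap f xs)
length-concatMap-≥ f (x ∷ xs) (here refl) = subst (length (f x) ≤_) (sym (length-++ (f x))) (m≤m+n _ _)
length-concatMap-≥ f (y ∷ xs) (there x∈)  = subst (_ ≤_) (sym (length-++ (f y)))
  (≤-trans (length-concatMap-≥ f xs x∈) (m≤n+m _ _))

reverse-++-∷-∷ : ∀ {A : Set} (L : List A) b a R → reverse (L ++ b ∷ a ∷ R) ≡ reverse R ++ a ∷ b ∷ reverse L
reverse-++-∷-∷ L b a R = begin
  reverse (L ++ b ∷ a ∷ R)               ≡⟨ reverse-++ L (b ∷ a ∷ R) ⟩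
  reverse (b ∷ a ∷ R) ++ reverse L       ≡⟨ cong (_++ reverse L) (reverse-++ (b ∷ a ∷ []) R) ⟩
  (reverse R ++ a ∷ b ∷ []) ++ reverse L ≡⟨ ++-assoc (reverse R) (a ∷ b ∷ []) (reverse L) ⟩
  reverse R ++ a ∷ b ∷ reverse L         ∎
  where open ≡-Reasoning

range-cons : ∀ n → range (suc n) ≡ 1 ∷ map suc (range n)
range-cons n = cong (λ xs → 1 ∷ map suc xs) (sym (map-upTo suc n))

range-snoc : ∀ n → range (suc n) ≡ range n ++ [ suc n ]
range-snoc n = trans (cong (map suc) (sym (upTo-∷ʳ n))) (map-++ suc (upTo n) [ n ])

length-range : ∀ n → length (range n) ≡ n
length-range n = trans (length-map suc (upTo n)) (length-upTo n)

∈-range⁺ : ∀ {n x} → 1 ≤ x → x ≤ n → x ∈ range n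
∈-range⁺ {x = suc i} _ i<n = ∈-map⁺ suc (∈-upTo⁺ i<n)

∈-range⁻ : ∀ {n x} → x ∈ range n → 1 ≤ x × x ≤ n
∈-range⁻ p with _ , i∈ , refl ← ∈-map⁻ suc p = s≤s z≤n , ∈-upTo⁻ i∈

range-sorted : ∀ n → AllPairs _<_ (range n)
range-sorted n = APP.map⁺ (AP.map s≤s (APP.applyUpTo⁺₁ id n (λ i<j _ → i<j)))

Unique-range : ∀ n → Unique (range n)
Unique-range n = AP.map (λ x<y x≡y → <-irrefl x≡y x<y) (range-sorted n)

Unique-↭-range : ∀ {n π} → π ↭ range n → Unique π
Unique-↭-range {n} p = PermSetoid.Unique-resp-↭ (setoid ℕ) (↭⇒↭ₛ (↭-sym p)) (Unique-range n)

∈-↭-range⁻ : ∀ {n π x} → π ↭ range n → x ∈ π → 1 ≤ x × x ≤ n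
∈-↭-range⁻ p x∈π = ∈-range⁻ (∈-resp-↭ p x∈π)

∈-↭-range⁺ : ∀ {n π x} → π ↭ range n → 1 ≤ x → x ≤ n → x ∈ π
∈-↭-range⁺ p 1≤x x≤n = ∈-resp-↭ (↭-sym p) (∈-range⁺ 1≤x x≤n)

insertions-split : ∀ {x : ℕ} ys {π} → π ∈ insertions x ys → ∃₂ λ L R → ys ≡ L ++ R × π ≡ L ++ x ∷ R
insertions-split []       (here refl) = [] , [] , refl , refl
insertions-split (y ∷ ys) (here refl) = [] , y ∷ ys , refl , refl
insertions-split (y ∷ ys) (there p)
  with _ , p′ , refl ← ∈-map⁻ (y ∷_) p
  with L , R , refl , refl ← insertions-split ys p′ = y ∷ L , R , refl , refl

∈-insertions : ∀ (x : ℕ) L R → L ++ x ∷ R ∈ insertions x (L ++ R)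
∈-insertions x []      []      = here refl
∈-insertions x []      (r ∷ R) = here refl
∈-insertions x (l ∷ L) R       = there (∈-map⁺ (l ∷_) (∈-insertions x L R))

Unique-insertions : ∀ x ys → x ∉ ys → Unique (insertions x ys)
Unique-insertions x []       _     = [] ∷ []
Unique-insertions x (y ∷ ys) x∉y∷ys =
  AllP.map⁺ (All.tabulate (λ _ eq → x∉y∷ys (here (proj₁ (∷-injective eq)))))
  ∷ UniqueP.map⁺ (proj₂ ∘ ∷-injective) (Unique-insertions x ys (x∉y∷ys ∘ there))

erase : ℕ → List ℕ → List ℕ
erase x = filter (λ y → ¬? (y ≟ x))

erase-insertions : ∀ {x} ys {π} → x ∉ ys → π ∈ insertions x ys → erase x π ≡ ys
erase-insertions {x} ys x∉ys p with L , R , refl , refl ← insertions-split ys p = begin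
  erase x (L ++ x ∷ R)          ≡⟨ filter-++ P? L (x ∷ R) ⟩
  erase x L ++ erase x (x ∷ R)  ≡⟨ cong (erase x L ++_) (filter-reject P? (λ x≢x → x≢x refl)) ⟩
  erase x L ++ erase x R        ≡⟨ filter-++ P? L R ⟨
  erase x (L ++ R)              ≡⟨ filter-all P? (All.tabulate (λ y∈ y≡x → x∉ys (subst (_∈ _) y≡x y∈))) ⟩
  L ++ R                        ∎
  where
  open ≡-Reasoning
  P? = λ y → ¬? (y ≟ x)

S-sound : ∀ n {π} → π ∈ S n → π ↭ range n
S-sound zero    (here refl) = ↭-refl
S-sound (suc n) p
  with ρ , ρ∈S , π∈ins ← find (∈-concatMap⁻ (insertions (suc n)) {xs = S n} p)
  with L , R , refl , refl ← insertions-split ρ π∈ins = begin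
  L ++ suc n ∷ R        ↭⟨ shift (suc n) L R ⟩
  suc n ∷ L ++ R        ↭⟨ ↭-prep (suc n) (S-sound n ρ∈S) ⟩
  suc n ∷ range n       ↭⟨ ∷↭∷ʳ (suc n) (range n) ⟩
  range n ++ [ suc n ]  ≡⟨ range-snoc n ⟨
  range (suc n)         ∎
  where open PermutationReasoning

S-complete : ∀ n {π} → π ↭ range n → π ∈ S n
S-complete zero    p rewrite ↭-empty-inv p = here refl
S-complete (suc n) {π} p = insert (∈-∃++ (∈-resp-↭ (↭-sym p′) (∈-++⁺ʳ (range n) (here refl))))
  where
  p′ : π ↭ range n ++ [ suc n ]
  p′ = subst (π ↭_) (range-snoc n) p
  insert : (∃₂ λ L R → π ≡ L ++ [ suc n ] ++ R) → π ∈ S (suc n)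
  insert (L , R , refl) = ∈-concatMap⁺ (insertions (suc n)) (lose (S-complete n L++R↭) (∈-insertions (suc n) L R))
    where
    L++R↭ : L ++ R ↭ range n
    L++R↭ = subst (L ++ R ↭_) (++-identityʳ (range n)) (drop-mid L (range n) p′)

length-S : ∀ n {π} → π ∈ S n → length π ≡ n
length-S n p = trans (↭-length (S-sound n p)) (length-range n)

Unique-S : ∀ n → Unique (S n)
Unique-S zero    = [] ∷ []
Unique-S (suc n) = Unique-concatMap⁺ (insertions (suc n)) (erase (suc n)) (Unique-S n)
  (λ ρ∈S → Unique-insertions (suc n) _ (sucn∉ ρ∈S))
  (λ ρ∈S → erase-insertions _ (sucn∉ ρ∈S))
  where
  sucn∉ : ∀ {ρ} → ρ ∈ S n → suc n ∉ ρ
  sucn∉ ρ∈S sucn∈ρ = <-irrefl refl (proj₂ (∈-↭-range⁻ (S-sound n ρ∈S) sucn∈ρ))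

-- Counting along an involution

map-involution-↭ : ∀ {A : Set} (f : A → A) {xs} → Unique xs →
  (∀ {x} → x ∈ xs → f x ∈ xs) → (∀ {x} → x ∈ xs → f (f x) ≡ x) → map f xs ↭ xs
map-involution-↭ f {xs} u closed involutive =
  ∼bag⇒↭ (unique∧set⇒bag (Unique-map⁺ f u injective) u (mk⇔ to from))
  where
  injective : ∀ {x y} → x ∈ xs → y ∈ xs → f x ≡ f y → x ≡ y
  injective x∈ y∈ fx≡fy = trans (sym (involutive x∈)) (trans (cong f fx≡fy) (involutive y∈))
  to : ∀ {z} → z ∈ map f xs → z ∈ xs
  to z∈ with _ , x∈ , refl ← ∈-map⁻ f z∈ = closed x∈
  from : ∀ {z} → z ∈ xs → z ∈ map f xs
  from z∈ = subst (_∈ map f xs) (involutive z∈) (∈-map⁺ f (closed z∈))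

filterᵇ-map : ∀ {A B : Set} (f : A → B) (p : A → Bool) (q : B → Bool) xs →
  (∀ {x} → x ∈ xs → q (f x) ≡ p x) → filterᵇ q (map f xs) ≡ map f (filterᵇ p xs)
filterᵇ-map f p q []       _       = refl
filterᵇ-map f p q (x ∷ xs) q∘f≡p with q (f x) | p x | q∘f≡p (here refl)
... | true  | .true  | refl = cong (f x ∷_) (filterᵇ-map f p q xs (q∘f≡p ∘ there))
... | false | .false | refl = filterᵇ-map f p q xs (q∘f≡p ∘ there)

length-filterᵇ-involution : ∀ {A : Set} (f : A → A) (p q : A → Bool) {xs} → Unique xs →
  (∀ {x} → x ∈ xs → f x ∈ xs) → (∀ {x} → x ∈ xs → f (f x) ≡ x) →
  (∀ {x} → x ∈ xs → q (f x) ≡ p x) → length (filterᵇ p xs) ≡ length (filterᵇ q xs)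
length-filterᵇ-involution f p q {xs} u closed involutive q∘f≡p = begin
  length (filterᵇ p xs)          ≡⟨ length-map f (filterᵇ p xs) ⟨
  length (map f (filterᵇ p xs))  ≡⟨ cong length (filterᵇ-map f p q xs q∘f≡p) ⟨
  length (filterᵇ q (map f xs))  ≡⟨ ↭-length (filter-↭ (T? ∘ q) (map-involution-↭ f u closed involutive)) ⟩
  length (filterᵇ q xs)          ∎
  where open ≡-Reasoning

data Adjacent {A : Set} (b a : A) : List A → Set where
  here  : ∀ {xs} → Adjacent b a (b ∷ a ∷ xs)
  there : ∀ {x xs} → Adjacent b a xs → Adjacent b a (x ∷ xs)

module _ {A : Set} {b a : A} where

  Adjacent-++⁺ˡ : ∀ {xs ys} → Adjacent b a xs → Adjacent b a (xs ++ ys)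
  Adjacent-++⁺ˡ here      = here
  Adjacent-++⁺ˡ (there p) = there (Adjacent-++⁺ˡ p)

  Adjacent-++⁺ʳ : ∀ xs {ys} → Adjacent b a ys → Adjacent b a (xs ++ ys)
  Adjacent-++⁺ʳ []       p = p
  Adjacent-++⁺ʳ (x ∷ xs) p = there (Adjacent-++⁺ʳ xs p)

  Adjacent-++⁻ : ∀ xs {ys} → Adjacent b a (xs ++ ys) →
    Adjacent b a xs ⊎ Adjacent b a ys ⊎ (b ∈ xs × ∃ λ ys′ → ys ≡ a ∷ ys′)
  Adjacent-++⁻ []            p         = inj₂ (inj₁ p)
  Adjacent-++⁻ (x ∷ [])      here      = inj₂ (inj₂ (here refl , _ , refl))
  Adjacent-++⁻ (x ∷ x′ ∷ xs) here      = inj₁ here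
  Adjacent-++⁻ (x ∷ xs)      (there p) with Adjacent-++⁻ xs p
  ... | inj₁ q               = inj₁ (there q)
  ... | inj₂ (inj₁ q)        = inj₂ (inj₁ q)
  ... | inj₂ (inj₂ (b∈ , r)) = inj₂ (inj₂ (there b∈ , r))

  Adjacent-∈ : ∀ {xs} → Adjacent b a xs → b ∈ xs
  Adjacent-∈ here      = here refl
  Adjacent-∈ (there p) = there (Adjacent-∈ p)

  Adjacent-split : ∀ {xs} → Adjacent b a xs → ∃₂ λ L R → xs ≡ L ++ b ∷ a ∷ R
  Adjacent-split (here {xs})  = [] , xs , refl
  Adjacent-split (there {x} p) with L , R , refl ← Adjacent-split p = x ∷ L , R , refl

Adjacent-reverse : ∀ {A : Set} {b a : A} {xs} → Adjacent b a xs → Adjacent a b (reverse xs)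
Adjacent-reverse {b = b} {a} p with L , R , refl ← Adjacent-split p =
  subst (Adjacent a b) (sym (reverse-++-∷-∷ L b a R)) (Adjacent-++⁺ʳ (reverse R) here)

Adjacent-map : ∀ {A B : Set} (f : A → B) {b a xs} → Adjacent b a xs → Adjacent (f b) (f a) (map f xs)
Adjacent-map f here      = here
Adjacent-map f (there p) = there (Adjacent-map f p)

Adjacent-concatMap : ∀ {A B : Set} (f : A → List B) {b a x} xs → x ∈ xs → Adjacent b a (f x) →
  Adjacent b a (concatMap f xs)
Adjacent-concatMap f (x ∷ xs) (here refl) p = Adjacent-++⁺ˡ p
Adjacent-concatMap f (y ∷ xs) (there x∈)  p = Adjacent-++⁺ʳ (f y) (Adjacent-concatMap f xs x∈ p)

nth-∈ : ∀ xs {j} → 1 ≤ j → j ≤ length xs → nth xs j ∈ xs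
nth-∈ (x ∷ xs) {suc zero}    _ _          = here refl
nth-∈ (x ∷ xs) {suc (suc j)} _ (s≤s j<xs) = there (nth-∈ xs (s≤s z≤n) j<xs)

nth-map : ∀ (f : ℕ → ℕ) xs {j} → 1 ≤ j → j ≤ length xs → nth (map f xs) j ≡ f (nth xs j)
nth-map f (x ∷ xs) {suc zero}    _ _          = refl
nth-map f (x ∷ xs) {suc (suc j)} _ (s≤s j<xs) = nth-map f xs (s≤s z≤n) j<xs

nth-++ˡ : ∀ xs ys {j} → 1 ≤ j → j ≤ length xs → nth (xs ++ ys) j ≡ nth xs j
nth-++ˡ (x ∷ xs) ys {suc zero}    _ _          = refl
nth-++ˡ (x ∷ xs) ys {suc (suc j)} _ (s≤s j<xs) = nth-++ˡ xs ys (s≤s z≤n) j<xs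

nth-∷ʳ : ∀ xs (x : ℕ) → nth (xs ++ [ x ]) (suc (length xs)) ≡ x
nth-∷ʳ []            x = refl
nth-∷ʳ (y ∷ [])      x = refl
nth-∷ʳ (y ∷ y′ ∷ xs) x = nth-∷ʳ (y′ ∷ xs) x

nth-∷-∸ : ∀ (x : ℕ) xs {m i} → i < m → nth (x ∷ xs) (suc m ∸ i) ≡ nth xs (m ∸ i)
nth-∷-∸ x xs {suc m} {zero}  _         = refl
nth-∷-∸ x xs {suc m} {suc i} (s≤s i<m) = nth-∷-∸ x xs i<m

nth-reverse : ∀ xs {j} → 1 ≤ j → j ≤ length xs → nth (reverse xs) j ≡ nth xs (suc (length xs) ∸ j)
nth-reverse (x ∷ xs) {suc i} _ (s≤s i≤∣xs∣) rewrite unfold-reverse x xs with m≤n⇒m<n∨m≡n i≤∣xs∣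
... | inj₁ i<∣xs∣ = begin
  nth (reverse xs ++ [ x ]) (suc i)  ≡⟨ nth-++ˡ (reverse xs) [ x ] (s≤s z≤n) (subst (i <_) (sym (length-reverse xs)) i<∣xs∣) ⟩
  nth (reverse xs) (suc i)           ≡⟨ nth-reverse xs (s≤s z≤n) i<∣xs∣ ⟩
  nth xs (length xs ∸ i)             ≡⟨ nth-∷-∸ x xs i<∣xs∣ ⟨
  nth (x ∷ xs) (suc (length xs) ∸ i) ∎
  where open ≡-Reasoning
... | inj₂ refl = begin
  nth (reverse xs ++ [ x ]) (suc (length xs))            ≡⟨ cong (λ l → nth (reverse xs ++ [ x ]) (suc l)) (length-reverse xs) ⟨
  nth (reverse xs ++ [ x ]) (suc (length (reverse xs)))  ≡⟨ nth-∷ʳ (reverse xs) x ⟩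
  x                                                      ≡⟨ cong (nth (x ∷ xs)) (m+n∸n≡m 1 (length xs)) ⟨
  nth (x ∷ xs) (suc (length xs) ∸ length xs)             ∎
  where open ≡-Reasoning

nth-strictMono : ∀ {xs} → AllPairs _<_ xs → ∀ {i j} → 1 ≤ i → i < j → j ≤ length xs → nth xs i < nth xs j
nth-strictMono {x ∷ xs} _         {suc zero}    {suc zero}    _ (s≤s ()) _
nth-strictMono {x ∷ xs} (x< ∷ _)  {suc zero}    {suc (suc j)} _ _          (s≤s j<xs) =
  All.lookup x< (nth-∈ xs (s≤s z≤n) j<xs)
nth-strictMono {x ∷ xs} (_ ∷ sxs) {suc (suc i)} {suc (suc j)} _ (s≤s i<j) (s≤s j<xs) =
  nth-strictMono sxs (s≤s z≤n) i<j j<xs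

nth-map-range : ∀ (f : ℕ → ℕ) {n x} → 1 ≤ x → x ≤ n → nth (map f (range n)) x ≡ f x
nth-map-range f {suc n} {suc zero}    _ _         = refl
nth-map-range f {suc n} {suc (suc x)} _ (s≤s x<n) = begin
  nth (map f (range (suc n))) (suc (suc x)) ≡⟨ cong (λ l → nth (map f l) (suc (suc x))) (range-cons n) ⟩
  nth (map f (map suc (range n))) (suc x)   ≡⟨ cong (λ l → nth l (suc x)) (map-∘ (range n)) ⟨
  nth (map (f ∘ suc) (range n)) (suc x)     ≡⟨ nth-map-range (f ∘ suc) (s≤s z≤n) x<n ⟩
  f (suc (suc x))                           ∎
  where open ≡-Reasoning

-- Reverse complement

reverseComplement : ℕ → List ℕ → List ℕ
reverseComplement n π = map (suc n ∸_) (reverse π)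

complement-range : ∀ n → map (suc n ∸_) (range n) ≡ reverse (range n)
complement-range zero    = refl
complement-range (suc n) = begin
  map (suc (suc n) ∸_) (range (suc n))                      ≡⟨ cong (map _) (range-snoc n) ⟩
  map (suc (suc n) ∸_) (range n ++ [ suc n ])               ≡⟨ map-++ _ (range n) [ suc n ] ⟩
  map (suc (suc n) ∸_) (range n) ++ [ suc (suc n) ∸ suc n ] ≡⟨ cong₂ (λ xs x → xs ++ [ x ]) suc-complement (m+n∸n≡m 1 n) ⟩
  map suc (map (suc n ∸_) (range n)) ++ [ 1 ]               ≡⟨ cong (λ xs → map suc xs ++ [ 1 ]) (complement-range n) ⟩
  map suc (reverse (range n)) ++ [ 1 ]                      ≡⟨ cong (_++ [ 1 ]) (reverse-map suc (range n)) ⟩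
  reverse (map suc (range n)) ++ [ 1 ]                      ≡⟨ unfold-reverse 1 (map suc (range n)) ⟨
  reverse (1 ∷ map suc (range n))                           ≡⟨ cong reverse (range-cons n) ⟨
  reverse (range (suc n))                                   ∎
  where
  open ≡-Reasoning
  suc-complement : map (suc (suc n) ∸_) (range n) ≡ map suc (map (suc n ∸_) (range n))
  suc-complement = trans (map-cong-local (All.tabulate (λ x∈ → +-∸-assoc 1 (m≤n⇒m≤1+n (proj₂ (∈-range⁻ x∈))))))
                         (map-∘ (range n))

reverseComplement-range : ∀ n → reverseComplement n (range n) ≡ range n
reverseComplement-range n = begin
  map (suc n ∸_) (reverse (range n))  ≡⟨ reverse-map (suc n ∸_) (range n) ⟩
  reverse (map (suc n ∸_) (range n))  ≡⟨ cong reverse (complement-range n) ⟩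
  reverse (reverse (range n))         ≡⟨ reverse-involutive (range n) ⟩
  range n                             ∎
  where open ≡-Reasoning

reverseComplement-involutive : ∀ n {π} → All (_≤ suc n) π → reverseComplement n (reverseComplement n π) ≡ π
reverseComplement-involutive n {π} π≤ = begin
  map c (reverse (map c (reverse π)))  ≡⟨ cong (map c) (reverse-map c (reverse π)) ⟨
  map c (map c (reverse (reverse π)))  ≡⟨ cong (map c ∘ map c) (reverse-involutive π) ⟩
  map c (map c π)                      ≡⟨ map-∘ π ⟨
  map (c ∘ c) π                        ≡⟨ map-id-local (All.map m∸[m∸n]≡n π≤) ⟩
  π                                    ∎
  where
  open ≡-Reasoning
  c = suc n ∸_

reverseComplement-↭ : ∀ n {π} → π ↭ range n → reverseComplement n π ↭ range n
reverseComplement-↭ n {π} p = begin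
  map (suc n ∸_) (reverse π)           ↭⟨ PermP.map⁺ _ (↭-reverse π) ⟩
  map (suc n ∸_) π                     ↭⟨ PermP.map⁺ _ p ⟩
  map (suc n ∸_) (range n)             ↭⟨ PermP.map⁺ _ (↭-reverse (range n)) ⟨
  reverseComplement n (range n)        ≡⟨ reverseComplement-range n ⟩
  range n                              ∎
  where open PermutationReasoning

reverseComplement-⊆ : ∀ n {xs ys} → xs ⊆ ys → reverseComplement n xs ⊆ reverseComplement n ys
reverseComplement-⊆ n xs⊆ys = SublistP.map⁺ (suc n ∸_) (SublistP.reverse⁺ xs⊆ys)

Adjacent-reverseComplement : ∀ n {b a π} → Adjacent b a π →
  Adjacent (suc n ∸ a) (suc n ∸ b) (reverseComplement n π)
Adjacent-reverseComplement n = Adjacent-map (suc n ∸_) ∘ Adjacent-reverse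

nth-reverseComplement : ∀ n xs {j} → 1 ≤ j → j ≤ length xs →
  nth (reverseComplement n xs) j ≡ suc n ∸ nth xs (suc (length xs) ∸ j)
nth-reverseComplement n xs 1≤j j≤∣xs∣ =
  trans (nth-map (suc n ∸_) (reverse xs) 1≤j (subst (_ ≤_) (sym (length-reverse xs)) j≤∣xs∣))
        (cong (suc n ∸_) (nth-reverse xs 1≤j j≤∣xs∣))

S-reverseComplement : ∀ n {π} → π ∈ S n → reverseComplement n π ∈ S n
S-reverseComplement n π∈S = S-complete n (reverseComplement-↭ n (S-sound n π∈S))

S-reverseComplement-involutive : ∀ n {π} → π ∈ S n → reverseComplement n (reverseComplement n π) ≡ π
S-reverseComplement-involutive n π∈S =
  reverseComplement-involutive n (All.tabulate (m≤n⇒m≤1+n ∘ proj₂ ∘ ∈-↭-range⁻ (S-sound n π∈S)))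

-- Cycle form and the descents of θ σ

orbitWalk : List ℕ → ℕ → ℕ → ℕ → List ℕ
orbitWalk σ m zero    y = []
orbitWalk σ m (suc f) y = if y ≡ᵇ m then [] else y ∷ orbitWalk σ m f (app σ y)

orbitWalk-unique : ∀ σ m (walk : ℕ → ℕ → List ℕ) → (∀ y → walk 0 y ≡ []) →
  (∀ f y → walk (suc f) y ≡ (if y ≡ᵇ m then [] else y ∷ walk f (app σ y))) →
  ∀ f y → walk f y ≡ orbitWalk σ m f y
orbitWalk-unique σ m walk walk0 walk-suc zero    y = walk0 y
orbitWalk-unique σ m walk walk0 walk-suc (suc f) y rewrite walk-suc f y with y ≡ᵇ m
... | true  = refl
... | false = cong (y ∷_) (orbitWalk-unique σ m walk walk0 walk-suc f (app σ y))

-- The local function of cycleFrom has no name; the meta `walk` is solved to it by unification.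
cycleFrom-orbitWalk : ∀ σ m → cycleFrom σ m ≡ m ∷ orbitWalk σ m (length σ) (app σ m)
cycleFrom-orbitWalk σ m = unfold
  where
  walk : ℕ → ℕ → List ℕ
  walk = _
  unfold : cycleFrom σ m ≡ m ∷ orbitWalk σ m (length σ) (app σ m)
  unfold with length σ | app σ m
  ... | f | y = cong (m ∷_) (orbitWalk-unique σ m walk (λ _ → refl) (λ _ _ → refl) f y)

cycleMaxima : List ℕ → List ℕ
cycleMaxima σ = filterᵇ (isCycleMax σ) (range (length σ))

θ-cycles : ∀ σ → θ σ ≡ concatMap (cycleFrom σ) (cycleMaxima σ)
θ-cycles σ = go (range (length σ))
  where
  go : ∀ ms → concatMap (λ c → c) (concatMap (λ m → if isCycleMax σ m then cycleFrom σ m ∷ [] else []) ms)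
              ≡ concatMap (cycleFrom σ) (filterᵇ (isCycleMax σ) ms)
  go []       = refl
  go (m ∷ ms) with isCycleMax σ m
  ... | true  = cong (cycleFrom σ m ++_) (go ms)
  ... | false = go ms

cycleMaxima-sorted : ∀ σ → AllPairs _<_ (cycleMaxima σ)
cycleMaxima-sorted σ = APP.filter⁺ (T? ∘ isCycleMax σ) (range-sorted (length σ))

∈-cycleMaxima⁻ : ∀ σ {m} → m ∈ cycleMaxima σ → T (isCycleMax σ m)
∈-cycleMaxima⁻ σ m∈ = proj₂ (∈-filter⁻ (T? ∘ isCycleMax σ) {xs = range (length σ)} m∈)

≤-cycleMax : ∀ σ {m y} → T (isCycleMax σ m) → y ∈ cycleFrom σ m → y ≤ m
≤-cycleMax σ {m} {y} isMax y∈ = ≤ᵇ⇒≤ y m (All.lookup (AllP.all⁺ (_≤ᵇ m) (cycleFrom σ m) isMax) y∈)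

module _ (σ : List ℕ) (m : ℕ) where

  orbitWalk-Adjacent : ∀ f x {b a} → Adjacent b a (x ∷ orbitWalk σ m f (app σ x)) → a ≡ app σ b
  orbitWalk-Adjacent zero    x (there ())
  orbitWalk-Adjacent (suc f) x p with app σ x ≡ᵇ m
  orbitWalk-Adjacent (suc f) x (there ()) | true
  orbitWalk-Adjacent (suc f) x here       | false = refl
  orbitWalk-Adjacent (suc f) x (there p)  | false = orbitWalk-Adjacent f (app σ x) p

  -- The last alternative is the walk running out of fuel.
  orbitWalk-∈ : ∀ f x {b} → b ∈ x ∷ orbitWalk σ m f (app σ x) →
    Adjacent b (app σ b) (x ∷ orbitWalk σ m f (app σ x)) ⊎ app σ b ≡ m ⊎
    length (x ∷ orbitWalk σ m f (app σ x)) ≡ suc f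
  orbitWalk-∈ zero    x (here refl) = inj₂ (inj₂ refl)
  orbitWalk-∈ (suc f) x p with app σ x ≡ᵇ m in eq
  orbitWalk-∈ (suc f) x (here refl) | true  = inj₂ (inj₁ (≡ᵇ⇒≡ _ _ (subst T (sym eq) _)))
  orbitWalk-∈ (suc f) x (here refl) | false = inj₁ here
  orbitWalk-∈ (suc f) x (there q)   | false with orbitWalk-∈ f (app σ x) q
  ... | inj₁ r        = inj₁ (there r)
  ... | inj₂ (inj₁ r) = inj₂ (inj₁ r)
  ... | inj₂ (inj₂ r) = inj₂ (inj₂ (cong suc r))

cycles-descent⇒app : ∀ σ {b a} ms → AllPairs _<_ ms → All (T ∘ isCycleMax σ) ms →
  Adjacent b a (concatMap (cycleFrom σ) ms) → a < b → app σ b ≡ a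
cycles-descent⇒app σ {b} {a} (m ∷ ms) (m< ∷ sorted) (isMax ∷ areMax) p a<b
  with Adjacent-++⁻ (cycleFrom σ m) p
... | inj₁ q = sym (orbitWalk-Adjacent σ m (length σ) m (subst (Adjacent b a) (cycleFrom-orbitWalk σ m) q))
... | inj₂ (inj₁ q) = cycles-descent⇒app σ ms sorted areMax q a<b
... | inj₂ (inj₂ (b∈ , _ , rest≡)) = ⊥-elim (boundary ms m< rest≡)
  where
  boundary : ∀ {ys} ms → All (m <_) ms → concatMap (cycleFrom σ) ms ≡ a ∷ ys → ⊥
  boundary (m′ ∷ _) (m<m′ ∷ _) eq with refl ← proj₁ (∷-injective eq) =
    <-irrefl refl (<-trans a<b (≤-<-trans (≤-cycleMax σ isMax b∈) m<m′))

θ-descent⇒app : ∀ σ {π b a} → θ σ ≡ π → Adjacent b a π → a < b → app σ b ≡ a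
θ-descent⇒app σ refl p = cycles-descent⇒app σ (cycleMaxima σ) (cycleMaxima-sorted σ)
  (All.tabulate (∈-cycleMaxima⁻ σ)) (subst (Adjacent _ _) (θ-cycles σ) p)

θ-app⇒descent : ∀ σ {π b a} → θ σ ≡ π → length π ≡ length σ → b ∈ π → app σ b ≡ a → a < b → Adjacent b a π
θ-app⇒descent σ {b = b} {a} refl ∣θσ∣≡∣σ∣ b∈θσ refl a<b
  with m , m∈ , b∈cycle ← find (∈-concatMap⁻ (cycleFrom σ) (subst (b ∈_) (θ-cycles σ) b∈θσ))
  with orbitWalk-∈ σ m (length σ) m (subst (b ∈_) (cycleFrom-orbitWalk σ m) b∈cycle)
... | inj₁ q = subst (Adjacent b a) (sym (θ-cycles σ))
  (Adjacent-concatMap (cycleFrom σ) (cycleMaxima σ) m∈ (subst (Adjacent b a) (sym (cycleFrom-orbitWalk σ m)) q))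
... | inj₂ (inj₁ a≡m) = ⊥-elim (<-irrefl refl (<-≤-trans a<b (subst (b ≤_) (sym a≡m)
  (≤-cycleMax σ (∈-cycleMaxima⁻ σ m∈) b∈cycle))))
... | inj₂ (inj₂ ∣cycle∣≡) = ⊥-elim (<-irrefl refl (begin-strict
  length σ                                          <⟨ n<1+n (length σ) ⟩
  suc (length σ)                                    ≡⟨ trans (cong length (cycleFrom-orbitWalk σ m)) ∣cycle∣≡ ⟨
  length (cycleFrom σ m)                            ≤⟨ length-concatMap-≥ (cycleFrom σ) (cycleMaxima σ) m∈ ⟩
  length (concatMap (cycleFrom σ) (cycleMaxima σ))  ≡⟨ cong length (θ-cycles σ) ⟨
  length (θ σ)                                      ≡⟨ ∣θσ∣≡∣σ∣ ⟩
  length σ                                          ∎))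
  where open ≤-Reasoning

-- Surjectivity of θ

Block : Set
Block = ℕ × List ℕ

block : Block → List ℕ
block (M , ys) = M ∷ ys

HeadIsMax : Block → Set
HeadIsMax (M , ys) = All (_< M) ys

record BlockDecomposition (π : List ℕ) (bs : List Block) : Set where
  field
    concat-blocks : concatMap block bs ≡ π
    heads-max     : All HeadIsMax bs
    heads-sorted  : AllPairs _<_ (map proj₁ bs)

open BlockDecomposition

head∈concat : ∀ bs {M} → M ∈ map proj₁ bs → M ∈ concatMap block bs
head∈concat ((M , ys) ∷ bs) (here refl) = here refl
head∈concat ((M , ys) ∷ bs) (there M∈)  = ∈-++⁺ʳ (M ∷ ys) (head∈concat bs M∈)

partition-heads : ∀ x bs → AllPairs _<_ (map proj₁ bs) → x ∉ map proj₁ bs →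
  Σ (List Block) λ lo → Σ (List Block) λ hi → bs ≡ lo ++ hi × All ((_< x) ∘ proj₁) lo × All ((x <_) ∘ proj₁) hi
partition-heads x []              _              _ = [] , [] , refl , [] , []
partition-heads x ((M , ys) ∷ bs) (M< ∷ sorted) x∉ with <-cmp M x
... | tri< M<x _ _ with lo , hi , refl , lo<x , x<hi ← partition-heads x bs sorted (x∉ ∘ there) =
  (M , ys) ∷ lo , hi , refl , M<x ∷ lo<x , x<hi
... | tri≈ _ M≡x _ = ⊥-elim (x∉ (here (sym M≡x)))
... | tri> _ _ x<M = [] , (M , ys) ∷ bs , refl , [] , x<M ∷ All.map (<-trans x<M) (AllP.map⁻ M<)

concat-below : ∀ x lo → All HeadIsMax lo → All ((_< x) ∘ proj₁) lo → All (_< x) (concatMap block lo)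
concat-below x []              _                  _              = []
concat-below x ((M , ys) ∷ lo) (ys<M ∷ lo-max) (M<x ∷ lo<x) =
  AllP.++⁺ (M<x ∷ All.map (λ y<M → <-trans y<M M<x) ys<M) (concat-below x lo lo-max lo<x)

-- Reading π from the right, each letter becomes the head of a block that swallows all blocks with smaller heads.
blockDecomposition : ∀ π → Unique π → ∃ (BlockDecomposition π)
blockDecomposition []      _          = [] , record { concat-blocks = refl ; heads-max = [] ; heads-sorted = [] }
blockDecomposition (x ∷ π) (x∉π ∷ unique-π)
  with bs , dec ← blockDecomposition π unique-π
  with lo , hi , refl , lo<x , x<hi ← partition-heads x bs (heads-sorted dec)
         (λ x∈ → All.lookup x∉π (subst (x ∈_) (concat-blocks dec) (head∈concat bs x∈)) refl) =
  (x , concatMap block lo) ∷ hi , record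
    { concat-blocks = cong (x ∷_) (trans (sym (concatMap-++ block lo hi)) (concat-blocks dec))
    ; heads-max     = concat-below x lo (AllP.++⁻ˡ lo (heads-max dec)) lo<x ∷ AllP.++⁻ʳ lo (heads-max dec)
    ; heads-sorted  = AllP.map⁺ x<hi
                      ∷ AllPairs-++⁻ʳ (map proj₁ lo) (subst (AllPairs _<_) (map-++ proj₁ lo hi) (heads-sorted dec))
    }

chain : ℕ → List ℕ → ℕ → List (ℕ × ℕ)
chain x []       w = [ (x , w) ]
chain x (y ∷ ys) w = (x , y) ∷ chain y ys w

map-proj₁-chain : ∀ x ys w → map proj₁ (chain x ys w) ≡ x ∷ ys
map-proj₁-chain x []       w = refl
map-proj₁-chain x (y ∷ ys) w = cong (x ∷_) (map-proj₁-chain y ys w)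

map-proj₂-chain : ∀ x ys w → map proj₂ (chain x ys w) ≡ ys ++ [ w ]
map-proj₂-chain x []       w = refl
map-proj₂-chain x (y ∷ ys) w = cong (y ∷_) (map-proj₂-chain y ys w)

chain-++ : ∀ x pre y post w → chain x (pre ++ y ∷ post) w ≡ chain x pre y ++ chain y post w
chain-++ x []        y post w = refl
chain-++ x (z ∷ pre) y post w = cong ((x , z) ∷_) (chain-++ z pre y post w)

Realises : List ℕ → List (ℕ × ℕ) → Set
Realises σ = All (λ kv → app σ (proj₁ kv) ≡ proj₂ kv)

module _ (σ : List ℕ) (m : ℕ) where

  orbitWalk-home : ∀ f → orbitWalk σ m f m ≡ []
  orbitWalk-home zero    = refl
  orbitWalk-home (suc f) rewrite ≡ᵇ-refl m = refl

  orbitWalk-away : ∀ f {y} → y ≢ m → orbitWalk σ m (suc f) y ≡ y ∷ orbitWalk σ m f (app σ y)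
  orbitWalk-away f y≢m rewrite ≢⇒≡ᵇ-false y≢m = refl

  ∈-orbitWalk-start : ∀ {f} w → 0 < f → w ≢ m → w ∈ orbitWalk σ m f w
  ∈-orbitWalk-start {suc f} w _ w≢m rewrite orbitWalk-away f w≢m = here refl

  orbitWalk-chain : ∀ f x zs w → Realises σ (chain x zs w) → m ∉ zs → length zs ≤ f →
    orbitWalk σ m f (app σ x) ≡ zs ++ orbitWalk σ m (f ∸ length zs) w
  orbitWalk-chain f       x []       w (σx≡w ∷ []) _ _ = cong (orbitWalk σ m f) σx≡w
  orbitWalk-chain (suc f) x (z ∷ zs) w (σx≡z ∷ realises) m∉ (s≤s ∣zs∣≤f) = begin
    orbitWalk σ m (suc f) (app σ x)            ≡⟨ cong (orbitWalk σ m (suc f)) σx≡z ⟩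
    orbitWalk σ m (suc f) z                    ≡⟨ orbitWalk-away f (λ z≡m → m∉ (here (sym z≡m))) ⟩
    z ∷ orbitWalk σ m f (app σ z)              ≡⟨ cong (z ∷_) (orbitWalk-chain f z zs w realises (m∉ ∘ there) ∣zs∣≤f) ⟩
    z ∷ zs ++ orbitWalk σ m (f ∸ length zs) w  ∎
    where open ≡-Reasoning

assoc : List (ℕ × ℕ) → ℕ → ℕ
assoc []             x = 0
assoc ((k , v) ∷ ps) x = if k ≡ᵇ x then v else assoc ps x

assoc-∈ : ∀ ps → Unique (map proj₁ ps) → ∀ {k v} → (k , v) ∈ ps → assoc ps k ≡ v
assoc-∈ ((k , v) ∷ ps)   _          (here refl) rewrite ≡ᵇ-refl k = refl
assoc-∈ ((k′ , v′) ∷ ps) (k′∉ ∷ u)  (there kv∈)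
  rewrite ≢⇒≡ᵇ-false (All.lookup k′∉ (∈-map⁺ proj₁ kv∈)) = assoc-∈ ps u kv∈

map-assoc : ∀ ps → Unique (map proj₁ ps) → map (assoc ps) (map proj₁ ps) ≡ map proj₂ ps
map-assoc ps u = trans (sym (map-∘ ps)) (map-cong-local (All.tabulate (assoc-∈ ps u)))

cyclePairs : Block → List (ℕ × ℕ)
cyclePairs (M , ys) = chain M ys M

-- σ₀ sends every letter of a block to the next one, and the last letter back to the head.
module Preimage {n π bs} (π↭ : π ↭ range n) (dec : BlockDecomposition π bs) where

  successors : List (ℕ × ℕ)
  successors = concatMap cyclePairs bs

  keys-successors : map proj₁ successors ≡ π
  keys-successors = begin
    map proj₁ (concatMap cyclePairs bs)         ≡⟨ map-concatMap proj₁ cyclePairs bs ⟩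
    concatMap (map proj₁ ∘ cyclePairs) bs       ≡⟨ concatMap-cong (λ B → map-proj₁-chain (proj₁ B) (proj₂ B) (proj₁ B)) bs ⟩
    concatMap block bs                          ≡⟨ concat-blocks dec ⟩
    π                                           ∎
    where open ≡-Reasoning

  unique-π : Unique π
  unique-π = Unique-↭-range π↭

  unique-keys : Unique (map proj₁ successors)
  unique-keys = subst Unique (sym keys-successors) unique-π

  σ₀ : List ℕ
  σ₀ = map (assoc successors) (range n)

  length-σ₀ : length σ₀ ≡ n
  length-σ₀ = trans (length-map _ (range n)) (length-range n)

  realises : Realises σ₀ successors
  realises = All.tabulate λ {kv} kv∈ →
    let 1≤k , k≤n = ∈-↭-range⁻ π↭ (subst (proj₁ kv ∈_) keys-successors (∈-map⁺ proj₁ kv∈))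
    in trans (nth-map-range (assoc successors) 1≤k k≤n) (assoc-∈ successors unique-keys kv∈)

  σ₀-↭ : σ₀ ↭ range n
  σ₀-↭ = begin
    map (assoc successors) (range n)                    ↭⟨ PermP.map⁺ _ (↭-sym π↭) ⟩
    map (assoc successors) π                            ≡⟨ cong (map _) keys-successors ⟨
    map (assoc successors) (map proj₁ successors)       ≡⟨ map-assoc successors unique-keys ⟩
    map proj₂ (concatMap cyclePairs bs)                 ≡⟨ map-concatMap proj₂ cyclePairs bs ⟩
    concatMap (map proj₂ ∘ cyclePairs) bs               ≡⟨ concatMap-cong (λ B → map-proj₂-chain (proj₁ B) (proj₂ B) (proj₁ B)) bs ⟩
    concatMap (λ B → proj₂ B ++ [ proj₁ B ]) bs         ↭⟨ concatMap-↭ (λ B → ↭-sym (∷↭∷ʳ (proj₁ B) (proj₂ B))) bs ⟩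
    concatMap block bs                                  ≡⟨ concat-blocks dec ⟩
    π                                                   ↭⟨ π↭ ⟩
    range n                                             ∎
    where open PermutationReasoning

  module _ {M ys} (B∈ : (M , ys) ∈ bs) where

    realises-block : Realises σ₀ (chain M ys M)
    realises-block = All.tabulate (λ kv∈ → All.lookup realises (∈-concatMap⁺ cyclePairs (lose B∈ kv∈)))

    unique-block : Unique (M ∷ ys)
    unique-block = Unique-concatMap⁻ block bs (subst Unique (sym (concat-blocks dec)) unique-π) B∈

    ys<M : All (_< M) ys
    ys<M = All.lookup (heads-max dec) B∈

    length-block : length ys < n
    length-block = begin
      length (M ∷ ys)            ≤⟨ length-concatMap-≥ block bs B∈ ⟩
      length (concatMap block bs) ≡⟨ cong length (concat-blocks dec) ⟩
      length π                    ≡⟨ ↭-length π↭ ⟩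
      length (range n)            ≡⟨ length-range n ⟩
      n                           ∎
      where open ≤-Reasoning

    cycleFrom-head : cycleFrom σ₀ M ≡ M ∷ ys
    cycleFrom-head = begin
      cycleFrom σ₀ M                                         ≡⟨ cycleFrom-orbitWalk σ₀ M ⟩
      M ∷ orbitWalk σ₀ M (length σ₀) (app σ₀ M)              ≡⟨ cong (λ f → M ∷ orbitWalk σ₀ M f (app σ₀ M)) length-σ₀ ⟩
      M ∷ orbitWalk σ₀ M n (app σ₀ M)                        ≡⟨ cong (M ∷_) (orbitWalk-chain σ₀ M n M ys M realises-block M∉ys (<⇒≤ length-block)) ⟩
      M ∷ ys ++ orbitWalk σ₀ M (n ∸ length ys) M             ≡⟨ cong (λ zs → M ∷ ys ++ zs) (orbitWalk-home σ₀ M (n ∸ length ys)) ⟩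
      M ∷ ys ++ []                                           ≡⟨ cong (M ∷_) (++-identityʳ ys) ⟩
      M ∷ ys                                                 ∎
      where
      open ≡-Reasoning
      M∉ys : M ∉ ys
      M∉ys M∈ = <-irrefl refl (All.lookup ys<M M∈)

    head∈cycleFrom-tail : ∀ {y} → y ∈ ys → M ∈ cycleFrom σ₀ y
    head∈cycleFrom-tail {y} y∈ with pre , post , refl ← ∈-∃++ y∈ =
      subst (M ∈_) (sym cycle-y) (there (∈-++⁺ʳ post (∈-orbitWalk-start σ₀ y M (m<n⇒0<n∸m ∣post∣<n) M≢y)))
      where
      open ≡-Reasoning
      M≢y : M ≢ y
      M≢y M≡y = <-irrefl (sym M≡y) (All.lookup ys<M y∈)
      y∉post : y ∉ post
      y∉post = UniqueP.Unique[x∷xs]⇒x∉xs (AllPairs-++⁻ʳ (M ∷ pre) unique-block)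
      ∣post∣<n : length post < n
      ∣post∣<n = <-trans (subst (length post <_) (sym (length-++ pre)) (m≤n+m (suc (length post)) (length pre)))
                         length-block
      realises-post : Realises σ₀ (chain y post M)
      realises-post = AllP.++⁻ʳ (chain M pre y) (subst (Realises σ₀) (chain-++ M pre y post M) realises-block)
      cycle-y : cycleFrom σ₀ y ≡ y ∷ post ++ orbitWalk σ₀ y (n ∸ length post) M
      cycle-y = begin
        cycleFrom σ₀ y                             ≡⟨ cycleFrom-orbitWalk σ₀ y ⟩
        y ∷ orbitWalk σ₀ y (length σ₀) (app σ₀ y)  ≡⟨ cong (λ f → y ∷ orbitWalk σ₀ y f (app σ₀ y)) length-σ₀ ⟩
        y ∷ orbitWalk σ₀ y n (app σ₀ y)            ≡⟨ cong (y ∷_) (orbitWalk-chain σ₀ y n y post M realises-post y∉post (<⇒≤ ∣post∣<n)) ⟩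
        y ∷ post ++ orbitWalk σ₀ y (n ∸ length post) M ∎

    isCycleMax-head : T (isCycleMax σ₀ M)
    isCycleMax-head = AllP.all⁻ (_≤ᵇ M)
      (subst (All (T ∘ (_≤ᵇ M))) (sym cycleFrom-head) (≤⇒≤ᵇ (≤-refl {M}) ∷ All.map (≤⇒≤ᵇ ∘ <⇒≤) ys<M))

    ¬isCycleMax-tail : ∀ {y} → y ∈ ys → ¬ T (isCycleMax σ₀ y)
    ¬isCycleMax-tail y∈ isMax =
      <-irrefl refl (<-≤-trans (All.lookup ys<M y∈) (≤-cycleMax σ₀ isMax (head∈cycleFrom-tail y∈)))

  cycleMaxima-σ₀ : cycleMaxima σ₀ ≡ map proj₁ bs
  cycleMaxima-σ₀ = strictlySorted-≡ (cycleMaxima-sorted σ₀) (heads-sorted dec) to from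
    where
    range-σ₀ : range (length σ₀) ≡ range n
    range-σ₀ = cong range length-σ₀
    to : ∀ {z} → z ∈ cycleMaxima σ₀ → z ∈ map proj₁ bs
    to {z} z∈ with z∈range , isMax ← ∈-filter⁻ (T? ∘ isCycleMax σ₀) {xs = range (length σ₀)} z∈
      with find (∈-concatMap⁻ block (subst (z ∈_) (sym (concat-blocks dec))
                                       (∈-resp-↭ (↭-sym π↭) (subst (z ∈_) range-σ₀ z∈range))))
    ... | _ , B∈ , here refl   = ∈-map⁺ proj₁ B∈
    ... | _ , B∈ , there z∈ys = ⊥-elim (¬isCycleMax-tail B∈ z∈ys isMax)
    from : ∀ {z} → z ∈ map proj₁ bs → z ∈ cycleMaxima σ₀
    from z∈ with (M , ys) , B∈ , refl ← ∈-map⁻ proj₁ z∈ =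
      ∈-filter⁺ (T? ∘ isCycleMax σ₀)
        (subst (M ∈_) (sym range-σ₀) (∈-resp-↭ π↭ (subst (M ∈_) (concat-blocks dec) (head∈concat bs (∈-map⁺ proj₁ B∈)))))
        (isCycleMax-head B∈)

  θ-σ₀ : θ σ₀ ≡ π
  θ-σ₀ = begin
    θ σ₀                                              ≡⟨ θ-cycles σ₀ ⟩
    concatMap (cycleFrom σ₀) (cycleMaxima σ₀)         ≡⟨ cong (concatMap (cycleFrom σ₀)) cycleMaxima-σ₀ ⟩
    concatMap (cycleFrom σ₀) (map proj₁ bs)           ≡⟨ concatMap-map (cycleFrom σ₀) proj₁ bs ⟩
    concatMap (cycleFrom σ₀ ∘ proj₁) bs               ≡⟨ cong concat (map-cong-local (All.tabulate cycleFrom-head)) ⟩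
    concatMap block bs                                ≡⟨ concat-blocks dec ⟩
    π                                                 ∎
    where open ≡-Reasoning

θ-surjective : ∀ n {π} → π ∈ S n → ∃ λ σ → σ ∈ S n × θ σ ≡ π
θ-surjective n {π} π∈S with bs , dec ← blockDecomposition π (Unique-↭-range (S-sound n π∈S)) =
  σ₀ , S-complete n σ₀-↭ , θ-σ₀
  where open Preimage (S-sound n π∈S) dec

-- The arrow k → 1 as a factor of π

hat-spec : ∀ n {π} → π ∈ S n → hat π ∈ S n × θ (hat π) ≡ π
hat-spec n {π} π∈S with σ , σ∈S , θσ≡π ← θ-surjective n π∈S = found
  where
  ∣π∣≡n : length π ≡ n
  ∣π∣≡n = length-S n π∈S
  found : hat π ∈ S n × θ (hat π) ≡ π
  found with filterᵇ (λ σ → does (≡-dec _≟_ (θ σ) π)) (S (length π)) in eq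
  ... | [] with () ← subst (σ ∈_) eq (∈-filter⁺ (T? ∘ λ σ → does (≡-dec _≟_ (θ σ) π))
                       (subst (λ k → σ ∈ S k) (sym ∣π∣≡n) σ∈S) (T-does⁺ (≡-dec _≟_ (θ σ) π) θσ≡π))
  ... | σ′ ∷ _
    with σ′∈S , θσ′≡π ← ∈-filter⁻ (T? ∘ λ σ → does (≡-dec _≟_ (θ σ) π)) {xs = S (length π)}
                                   (subst (σ′ ∈_) (sym eq) (here refl)) =
    subst (λ k → σ′ ∈ S k) ∣π∣≡n σ′∈S , T-does⁻ (≡-dec _≟_ (θ σ′) π) θσ′≡π

app-hat⇒Adjacent : ∀ n {π b a} → π ∈ S n → b ∈ π → app (hat π) b ≡ a → a < b → Adjacent b a π
app-hat⇒Adjacent n {π} π∈S b∈π σb≡a a<b with hat∈S , θhat≡π ← hat-spec n π∈S =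
  θ-app⇒descent (hat π) θhat≡π (trans (length-S n π∈S) (sym (length-S n hat∈S))) b∈π σb≡a a<b

Adjacent⇒app-hat : ∀ n {π b a} → π ∈ S n → Adjacent b a π → a < b → app (hat π) b ≡ a
Adjacent⇒app-hat n {π} π∈S ba a<b = θ-descent⇒app (hat π) (proj₂ (hat-spec n π∈S)) ba a<b

record Occurrence (k : ℕ) (ν : List ℕ) (b c : ℕ) (π : List ℕ) : Set where
  field
    points  : List ℕ
    points⊆ : points ⊆ range (length π)
    #points : length points ≡ k
    word⊆   : map (nth points) ν ⊆ π
    arrow   : app (hat π) (nth points b) ≡ nth points c

∈-choose⁻ : ∀ k xs {X} → X ∈ choose k xs → X ⊆ xs × length X ≡ k
∈-choose⁻ zero    xs       (here refl) = SublistP.[]⊆-universal xs , refl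
∈-choose⁻ (suc k) (x ∷ xs) X∈ with ∈-++⁻ (map (x ∷_) (choose k xs)) X∈
... | inj₁ X∈with-x with Y , Y∈ , refl ← ∈-map⁻ (x ∷_) X∈with-x =
  let Y⊆ , ∣Y∣ = ∈-choose⁻ k xs Y∈ in refl ∷ Y⊆ , cong suc ∣Y∣
... | inj₂ X∈without-x = let X⊆ , ∣X∣ = ∈-choose⁻ (suc k) xs X∈without-x in x ∷ʳ X⊆ , ∣X∣

∈-choose⁺ : ∀ k xs {X} → X ⊆ xs → length X ≡ k → X ∈ choose k xs
∈-choose⁺ zero    xs       {[]}    _          refl = here refl
∈-choose⁺ (suc k) (x ∷ xs)         (x ∷ʳ X⊆)  ∣X∣  = ∈-++⁺ʳ (map (x ∷_) (choose k xs)) (∈-choose⁺ (suc k) xs X⊆ ∣X∣)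
∈-choose⁺ (suc k) (x ∷ xs) {x ∷ X} (refl ∷ X⊆) ∣X∣ = ∈-++⁺ˡ (∈-map⁺ (x ∷_) (∈-choose⁺ k xs X⊆ (suc-injective ∣X∣)))

contains-sound : ∀ k ν b c π → T (contains ⟨ k , ν , (b , c) ∷ [] ⟩ π) → Occurrence k ν b c π
contains-sound k ν b c π contains-π
  with X , X∈ , found ← find (AnyP.any⁻ _ (choose k (range (length π))) contains-π)
  with word , rest ← Equivalence.to T-∧ found
  with arrow , _ ← Equivalence.to T-∧ rest =
  record
    { points  = X
    ; points⊆ = proj₁ (∈-choose⁻ k (range (length π)) X∈)
    ; #points = proj₂ (∈-choose⁻ k (range (length π)) X∈)
    ; word⊆   = T-does⁻ (map (nth X) ν ⊆? π) word
    ; arrow   = ≡ᵇ⇒≡ _ _ arrow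
    }

contains-complete : ∀ k ν b c π → Occurrence k ν b c π → T (contains ⟨ k , ν , (b , c) ∷ [] ⟩ π)
contains-complete k ν b c π occ = AnyP.any⁺ _ (lose (∈-choose⁺ k (range (length π)) points⊆ #points)
  (Equivalence.from T-∧ (T-does⁺ (map (nth points) ν ⊆? π) word⊆ , Equivalence.from T-∧ (≡⇒≡ᵇ _ _ arrow , _))))
  where open Occurrence occ

-- Transfer of occurrences along the reverse complement

complement₁ : ℕ → ℕ → ℕ
complement₁ m t = if t ≡ᵇ 1 then 1 else (m + 2) ∸ t

complement₁-≢1 : ∀ m {t} → t ≢ 1 → complement₁ m t ≡ (m + 2) ∸ t
complement₁-≢1 m {t} t≢1 = cong (if_then 1 else ((m + 2) ∸ t)) (≢⇒≡ᵇ-false t≢1)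

2≤m+2∸n : ∀ m {t} → t ≤ m → 2 ≤ (m + 2) ∸ t
2≤m+2∸n m {t} t≤m = subst (2 ≤_) (sym (+-∸-comm 2 t≤m)) (m≤n+m 2 (m ∸ t))

complement₁-bounds : ∀ {m t} → 1 ≤ t → t ≤ m → 1 ≤ complement₁ m t × complement₁ m t ≤ m
complement₁-bounds {m} {suc zero}    _ 1≤m = ≤-refl , 1≤m
complement₁-bounds {m} {suc (suc s)} _ t≤m = <⇒≤ (2≤m+2∸n m t≤m) , ≤m
  where
  ≤m : (m + 2) ∸ suc (suc s) ≤ m
  ≤m = subst ((m + 2) ∸ suc (suc s) ≤_) (m+n∸n≡m m 2) (∸-monoʳ-≤ (m + 2) (s≤s (s≤s z≤n)))

complement₁-involutive : ∀ {m t} → 1 ≤ t → t ≤ m → complement₁ m (complement₁ m t) ≡ t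
complement₁-involutive {m} {suc zero}    _ _   = refl
complement₁-involutive {m} {suc (suc s)} _ t≤m = begin
  complement₁ m ((m + 2) ∸ suc (suc s))  ≡⟨ complement₁-≢1 m (λ eq → <-irrefl (sym eq) (2≤m+2∸n m t≤m)) ⟩
  (m + 2) ∸ ((m + 2) ∸ suc (suc s))      ≡⟨ m∸[m∸n]≡n (≤-trans t≤m (m≤m+n m 2)) ⟩
  suc (suc s)                            ∎
  where open ≡-Reasoning

c₁-reverse : ∀ ν → c₁ (reverse ν) ≡ map (complement₁ (length ν)) (reverse ν)
c₁-reverse ν = cong (λ l → map (complement₁ l) (reverse ν)) (length-reverse ν)

c₁-reverse-bounds : ∀ {m} ν → All (λ t → 1 ≤ t × t ≤ m) ν → length ν ≡ m →
  All (λ t → 1 ≤ t × t ≤ m) (c₁ (reverse ν)) × length (c₁ (reverse ν)) ≡ m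
c₁-reverse-bounds ν bounds refl rewrite c₁-reverse ν =
  AllP.map⁺ (All.map (λ (1≤t , t≤m) → complement₁-bounds 1≤t t≤m) (All-resp-↭ (↭-sym (↭-reverse ν)) bounds)) ,
  trans (length-map _ (reverse ν)) (length-reverse ν)

c₁-reverse-involutive : ∀ ν → All (λ t → 1 ≤ t × t ≤ length ν) ν → c₁ (reverse (c₁ (reverse ν))) ≡ ν
c₁-reverse-involutive ν bounds = begin
  c₁ (reverse (c₁ (reverse ν)))                 ≡⟨ cong c₁ reverse-c₁ ⟩
  map (complement₁ (length (map f ν))) (map f ν) ≡⟨ cong (λ l → map (complement₁ l) (map f ν)) (length-map f ν) ⟩
  map f (map f ν)                               ≡⟨ map-∘ ν ⟨
  map (f ∘ f) ν                                 ≡⟨ map-id-local (All.map (λ (1≤t , t≤m) → complement₁-involutive 1≤t t≤m) bounds) ⟩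
  ν                                             ∎
  where
  open ≡-Reasoning
  f = complement₁ (length ν)
  reverse-c₁ : reverse (c₁ (reverse ν)) ≡ map f ν
  reverse-c₁ = begin
    reverse (c₁ (reverse ν))         ≡⟨ cong reverse (c₁-reverse ν) ⟩
    reverse (map f (reverse ν))      ≡⟨ reverse-map f (reverse ν) ⟨
    map f (reverse (reverse ν))      ≡⟨ cong (map f) (reverse-involutive ν) ⟩
    map f ν                          ∎

replace : ℕ → ℕ → ℕ → ℕ
replace u v z = if z ≡ᵇ u then v else z

map-replace-∉ : ∀ u v xs → u ∉ xs → map (replace u v) xs ≡ xs
map-replace-∉ u v xs u∉ = map-id-local (All.tabulate λ {z} z∈ →
  cong (if_then v else z) (≢⇒≡ᵇ-false (λ z≡u → u∉ (subst (_∈ xs) z≡u z∈))))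

⊆-replace-Adjacent : ∀ {u v xs ys} → Unique ys → Adjacent u v ys → v ∉ xs → xs ⊆ ys → map (replace u v) xs ⊆ ys
⊆-replace-Adjacent {u} {v} {xs} ((_ ∷ u∉B) ∷ _) here v∉ (u ∷ʳ xs⊆) =
  subst (_⊆ _) (sym (map-replace-∉ u v xs (λ u∈ → All.lookup u∉B (SublistP.Any-resp-⊆ xs⊆B u∈) refl))) (u ∷ʳ (v ∷ʳ xs⊆B))
  where
  xs⊆B = ⊆-∷⁻ v∉ xs⊆
⊆-replace-Adjacent {u} {v} {u ∷ xs} {ys} ((_ ∷ u∉B) ∷ _) here v∉ (refl ∷ xs⊆) =
  subst (_⊆ ys) (sym (cong₂ _∷_ (cong (if_then v else u) (≡ᵇ-refl u))
                                (map-replace-∉ u v xs (λ u∈ → All.lookup u∉B (SublistP.Any-resp-⊆ xs⊆B u∈) refl))))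
    (u ∷ʳ (refl ∷ xs⊆B))
  where
  xs⊆B = ⊆-∷⁻ (v∉ ∘ there) xs⊆
⊆-replace-Adjacent (_ ∷ u-ys) (there uv) v∉ (y ∷ʳ xs⊆) = y ∷ʳ ⊆-replace-Adjacent u-ys uv v∉ xs⊆
⊆-replace-Adjacent {u} {v} {y ∷ xs} {ys} (y∉ys ∷ u-ys) (there uv) v∉ (refl ∷ xs⊆) =
  subst (_⊆ ys) (cong (_∷ map (replace u v) xs) (sym (cong (if_then v else y) (≢⇒≡ᵇ-false y≢u))))
    (refl ∷ ⊆-replace-Adjacent u-ys uv (v∉ ∘ there) xs⊆)
  where
  y≢u : y ≢ u
  y≢u = All.lookup y∉ys (Adjacent-∈ uv)

module Transfer {n m} (1≤m : 1 ≤ m) {ν} (letters : All (λ t → 1 ≤ t × t ≤ m) ν) (∣ν∣≡m : length ν ≡ m)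
                {π} (π∈S : π ∈ S n) (occ : Occurrence (suc m) ν (suc m) 1 π) where

  open Occurrence occ renaming (points to X)

  c : ℕ → ℕ
  c = suc n ∸_

  x : ℕ → ℕ
  x = nth X

  π′ : List ℕ
  π′ = reverseComplement n π

  π′∈S : π′ ∈ S n
  π′∈S = S-reverseComplement n π∈S

  X⊆range : X ⊆ range n
  X⊆range = subst (λ l → X ⊆ range l) (length-S n π∈S) points⊆

  x-bounds : ∀ {j} → 1 ≤ j → j ≤ suc m → 1 ≤ x j × x j ≤ n
  x-bounds 1≤j j≤k = ∈-range⁻ (SublistP.Any-resp-⊆ X⊆range (nth-∈ X 1≤j (subst (_ ≤_) (sym #points) j≤k)))

  x≤1+n : ∀ {j} → 1 ≤ j → j ≤ suc m → x j ≤ suc n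
  x≤1+n 1≤j j≤k = m≤n⇒m≤1+n (proj₂ (x-bounds 1≤j j≤k))

  x-mono : ∀ {i j} → 1 ≤ i → i < j → j ≤ suc m → x i < x j
  x-mono 1≤i i<j j≤k =
    nth-strictMono (AllPairs-⊆ X⊆range (range-sorted n)) 1≤i i<j (subst (_ ≤_) (sym #points) j≤k)

  c-injective : ∀ {i j} → 1 ≤ i → i ≤ suc m → 1 ≤ j → j ≤ suc m → c (x i) ≡ c (x j) → x i ≡ x j
  c-injective 1≤i i≤k 1≤j j≤k = ∸-cancelˡ-≡ (x≤1+n 1≤i i≤k) (x≤1+n 1≤j j≤k)

  x₁<xₖ : x 1 < x (suc m)
  x₁<xₖ = x-mono ≤-refl (s≤s 1≤m) ≤-refl

  factor : Adjacent (x (suc m)) (x 1) π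
  factor = app-hat⇒Adjacent n π∈S
    (∈-↭-range⁺ (S-sound n π∈S) (proj₁ (x-bounds (s≤s z≤n) ≤-refl)) (proj₂ (x-bounds (s≤s z≤n) ≤-refl)))
    arrow x₁<xₖ

  factor′ : Adjacent (c (x 1)) (c (x (suc m))) π′
  factor′ = Adjacent-reverseComplement n factor

  arrow′ : app (hat π′) (c (x 1)) ≡ c (x (suc m))
  arrow′ = Adjacent⇒app-hat n π′∈S factor′ (∸-monoʳ-< x₁<xₖ (x≤1+n (s≤s z≤n) ≤-refl))

  X′ : List ℕ
  X′ = reverseComplement n X

  #X′ : length X′ ≡ suc m
  #X′ = trans (length-map c (reverse X)) (trans (length-reverse X) #points)

  X′⊆ : X′ ⊆ range (length π′)
  X′⊆ = subst (X′ ⊆_) (trans (reverseComplement-range n) (cong range (sym (length-S n π′∈S))))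
              (reverseComplement-⊆ n X⊆range)

  nth-X′ : ∀ {j} → 1 ≤ j → j ≤ suc m → nth X′ j ≡ c (x (suc (suc m) ∸ j))
  nth-X′ {j} 1≤j j≤k = trans (nth-reverseComplement n X 1≤j (subst (_ ≤_) (sym #points) j≤k))
                             (cong (λ l → c (x (suc l ∸ j))) #points)

  nth-X′-1 : nth X′ 1 ≡ c (x (suc m))
  nth-X′-1 = nth-X′ ≤-refl (s≤s z≤n)

  nth-X′-k : nth X′ (suc m) ≡ c (x 1)
  nth-X′-k = trans (nth-X′ (s≤s z≤n) ≤-refl) (cong (c ∘ x) (m+n∸n≡m 1 m))

  nth-X′-complement₁ : ∀ {t} → 1 ≤ t → t ≤ m →
    nth X′ (complement₁ m t) ≡ replace (c (x 1)) (c (x (suc m))) (c (x t))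
  nth-X′-complement₁ {suc zero} _ _ rewrite ≡ᵇ-refl (c (x 1)) = nth-X′-1
  nth-X′-complement₁ {t@(suc (suc s))} 1≤t t≤m = begin
    nth X′ ((m + 2) ∸ t)                         ≡⟨ nth-X′ 1≤t′ (m≤n⇒m≤1+n t′≤m) ⟩
    c (x (suc (suc m) ∸ ((m + 2) ∸ t)))          ≡⟨ cong (λ l → c (x (l ∸ ((m + 2) ∸ t)))) (+-comm 2 m) ⟩
    c (x ((m + 2) ∸ ((m + 2) ∸ t)))              ≡⟨ cong (c ∘ x) (m∸[m∸n]≡n (≤-trans t≤m (m≤m+n m 2))) ⟩
    c (x t)                                      ≡⟨ cong (if_then c (x (suc m)) else c (x t)) (≢⇒≡ᵇ-false cxₜ≢cx₁) ⟨
    replace (c (x 1)) (c (x (suc m))) (c (x t))  ∎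
    where
    open ≡-Reasoning
    1≤t′ = proj₁ (complement₁-bounds 1≤t t≤m)
    t′≤m = proj₂ (complement₁-bounds 1≤t t≤m)
    t≤k = m≤n⇒m≤1+n t≤m
    cxₜ≢cx₁ : c (x t) ≢ c (x 1)
    cxₜ≢cx₁ eq = <-irrefl (sym (c-injective 1≤t t≤k ≤-refl (s≤s z≤n) eq)) (x-mono ≤-refl (s≤s (s≤s z≤n)) t≤k)

  letters-reverse : All (λ t → 1 ≤ t × t ≤ m) (reverse ν)
  letters-reverse = All-resp-↭ (↭-sym (↭-reverse ν)) letters

  reverseComplement-word : reverseComplement n (map x ν) ≡ map (c ∘ x) (reverse ν)
  reverseComplement-word = trans (cong (map c) (sym (reverse-map x ν))) (sym (map-∘ (reverse ν)))

  word-occurrence : map (nth X′) (c₁ (reverse ν)) ≡ map (replace (c (x 1)) (c (x (suc m)))) (map (c ∘ x) (reverse ν))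
  word-occurrence = begin
    map (nth X′) (c₁ (reverse ν))                    ≡⟨ cong (map (nth X′)) (c₁-reverse ν) ⟩
    map (nth X′) (map (complement₁ (length ν)) (reverse ν)) ≡⟨ cong (λ l → map (nth X′) (map (complement₁ l) (reverse ν))) ∣ν∣≡m ⟩
    map (nth X′) (map (complement₁ m) (reverse ν))   ≡⟨ map-∘ (reverse ν) ⟨
    map (nth X′ ∘ complement₁ m) (reverse ν)         ≡⟨ map-cong-local (All.map (λ (1≤t , t≤m) → nth-X′-complement₁ 1≤t t≤m) letters-reverse) ⟩
    map (replace _ _ ∘ (c ∘ x)) (reverse ν)          ≡⟨ map-∘ (reverse ν) ⟩
    map (replace _ _) (map (c ∘ x) (reverse ν))      ∎
    where open ≡-Reasoning

  cxₖ∉reverseComplement-word : c (x (suc m)) ∉ map (c ∘ x) (reverse ν)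
  cxₖ∉reverseComplement-word cxₖ∈ with t , t∈ , eq ← ∈-map⁻ (c ∘ x) cxₖ∈ =
    let 1≤t , t≤m = All.lookup letters-reverse t∈ in
    <-irrefl (sym (c-injective (s≤s z≤n) ≤-refl 1≤t (m≤n⇒m≤1+n t≤m) eq)) (x-mono 1≤t (s≤s t≤m) ≤-refl)

  occurrence : Occurrence (suc m) (c₁ (reverse ν)) (suc m) 1 π′
  occurrence = record
    { points  = X′
    ; points⊆ = X′⊆
    ; #points = #X′
    ; word⊆   = subst (_⊆ π′) (sym word-occurrence)
                  (⊆-replace-Adjacent (Unique-↭-range (S-sound n π′∈S)) factor′ cxₖ∉reverseComplement-word
                    (subst (_⊆ π′) reverseComplement-word (reverseComplement-⊆ n word⊆)))
    ; arrow   = trans (cong (app (hat π′)) nth-X′-k) (trans arrow′ (sym nth-X′-1))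
    }

contains-reverseComplement : ∀ {n m} → 1 ≤ m → ∀ ν → All (λ t → 1 ≤ t × t ≤ m) ν → length ν ≡ m →
  ∀ {π} → π ∈ S n → T (contains ⟨ suc m , ν , (suc m , 1) ∷ [] ⟩ π) →
  T (contains ⟨ suc m , c₁ (reverse ν) , (suc m , 1) ∷ [] ⟩ (reverseComplement n π))
contains-reverseComplement 1≤m ν letters ∣ν∣≡m {π} π∈S =
  contains-complete _ _ _ _ _ ∘ Transfer.occurrence 1≤m letters ∣ν∣≡m π∈S ∘ contains-sound _ ν _ _ π

contains-reverseComplement-≡ : ∀ {n m} ν → 1 ≤ m → All (λ t → 1 ≤ t × t ≤ m) ν → length ν ≡ m →
  ∀ {π} → π ∈ S n →
  contains ⟨ suc m , ν , (suc m , 1) ∷ [] ⟩ π ≡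
  contains ⟨ suc m , c₁ (reverse ν) , (suc m , 1) ∷ [] ⟩ (reverseComplement n π)
contains-reverseComplement-≡ {n} ν 1≤m letters refl {π} π∈S =
  T-ext (contains-reverseComplement 1≤m ν letters refl π∈S) backward
  where
  ν′ = c₁ (reverse ν)
  pattern-with : List ℕ → ArrowPattern
  pattern-with μ = ⟨ suc (length ν) , μ , (suc (length ν) , 1) ∷ [] ⟩
  backward : T (contains (pattern-with ν′) (reverseComplement n π)) → T (contains (pattern-with ν) π)
  backward =
    subst₂ (λ μ ρ → T (contains (pattern-with μ) ρ)) (c₁-reverse-involutive ν letters) (S-reverseComplement-involutive n π∈S)
    ∘ contains-reverseComplement 1≤m ν′ (proj₁ (c₁-reverse-bounds ν letters refl)) (proj₂ (c₁-reverse-bounds ν letters refl))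
        (S-reverseComplement n π∈S)

proposition2p6 : (n k : ℕ) → 1 ≤ n → 1 ≤ k → (ν : List ℕ) → ν ∈ S (k ∸ 1) →
    a n ⟨ k , ν , (k , 1) ∷ [] ⟩ ≡ a n ⟨ k , c₁ (reverse ν) , (k , 1) ∷ [] ⟩
proposition2p6 n (suc zero)    _ _ .[] (here refl) = refl
proposition2p6 n (suc (suc m)) _ _ ν   ν∈S =
  length-filterᵇ-involution (reverseComplement n) _ _ (Unique-S n) (S-reverseComplement n)
    (S-reverseComplement-involutive n)
    (cong not ∘ sym ∘ contains-reverseComplement-≡ ν (s≤s z≤n) letters (length-S (suc m) ν∈S))
  where
  letters : All (λ t → 1 ≤ t × t ≤ suc m) ν
  letters = All.tabulate (∈-↭-range⁻ (S-sound (suc m) ν∈S))
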